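{- Let $\hat b_n$ be the ruler function (the number of times $2n$ can be divided by $2$), let $\hat a_n=\min\{k\ge1:\sum_{i=1}^k\hat b_i\ge n\}$ for $n\ge1$, and for $h\ge1$ let $\hat A_h$ be the finite sequence $\hat a_1,\ldots,\hat a_{2^h-h}$. Then for every positive integer $h$, $\hat A_{h+1}$ is the concatenation \[ \hat A_{h+1}=\hat A_h,\ \underbrace{2^{h-1},\ldots,2^{h-1}}_{h-1\text{ times}},\ \hat A_h+2^{h-1}, \] where $\hat A_h+c$ denotes the sequence $\hat a_1+c,\hat a_2+c,\ldots,\hat a_{2^h-h}+c$.
   Context: The sequence $(\hat a_n)_{n\ge1}=1,2,2,3,4,4,4,5,6,6,7,8,\dots$ is the nondecreasing sequence in which each $k\ge1$ appears exactly $\hat b_k$ times. -}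

module Defs where

open import Data.Nat using (ℕ; zero; suc; _+_; _*_; _∸_; _^_; _≤?_; _%_; _/_)
open import Data.Nat.Properties using (_≟_)
open import Data.List using (List; map; upTo)
open import Relation.Nullary using (yes; no)

-- Number of times m can be divided by 2 (m > 0), computed with fuel f;
-- fuel m is always sufficient since each division halves m.
div2count : ℕ → ℕ → ℕ
div2count zero    m = zero
div2count (suc f) zero = zero
div2count (suc f) (suc m) with (suc m) % 2 ≟ 0
... | yes _ = suc (div2count f ((suc m) / 2))
... | no  _ = zero

bhat : ℕ → ℕ
bhat n = div2count (2 * n) (2 * n)

bsum : ℕ → ℕ
bsum zero    = zero
bsum (suc k) = bsum k + bhat (suc k)

search : ℕ → ℕ → ℕ → ℕ
search zero     start n = start
search (suc f)  start n with n ≤? bsum start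
... | yes _ = start
... | no  _ = search f (suc start) n

-- â n = min { k ≥ 1 : Σ_{i=1}^k b̂ i ≥ n }  (for n ≥ 1).
-- Fuel n suffices since b̂ i ≥ 1, hence bsum n ≥ n.
ahat : ℕ → ℕ
ahat n = search n 1 n

Ahat : ℕ → List ℕ
Ahat h = map (λ i → ahat (suc i)) (upTo (2 ^ h ∸ h))

module Submission where

-- The ruler function is b̂ = 1 + ν₂, so b̂ (2 ^ q) = q + 1 while b̂ (2 ^ q + j) = b̂ j for
-- 0 < j < 2 ^ q. Summing, the partial sums B k = b̂ 1 + … + b̂ k satisfy
-- B (2 ^ q + j) = B (2 ^ q) + B j for j < 2 ^ q and B (2 ^ q) = 2 ^ (q + 1) − 1, so past
-- position B (2 ^ q) the runs of â repeat those before it with values shifted by 2 ^ q.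
-- Â (q + 1) stops right after the first of the q + 1 copies of 2 ^ q; the other q copies
-- follow, and then the shifted copy of Â (q + 1).

open import Defs
open import Data.Nat
open import Data.Nat.Properties
open import Data.Nat.DivMod using (m/n<m; m*n/n≡m; m*n%n≡0; [m+kn]%n≡m%n)
open import Data.Nat.Tactic.RingSolver using (solve-∀)
open import Data.List using (_∷_; _++_; map; replicate; applyUpTo; upTo)
open import Data.List.Properties using (map-upTo; map-applyUpTo)
open import Data.Product using (∃-syntax; _×_; _,_)
open import Data.Sum using (inj₁; inj₂)
open import Function using (_∘_)
open import Relation.Nullary using (yes; no)
open import Relation.Nullary.Negation using (contradiction)
open import Relation.Binary.PropositionalEquality

ν₂ : ℕ → ℕ
ν₂ m = div2count m m

div2count-fuel : ∀ {f g} m → m ≤ f → m ≤ g → div2count f m ≡ div2count g m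
div2count-fuel {zero}  {zero}  zero _ _ = refl
div2count-fuel {zero}  {suc g} zero _ _ = refl
div2count-fuel {suc f} {zero}  zero _ _ = refl
div2count-fuel {suc f} {suc g} zero _ _ = refl
div2count-fuel {suc f} {suc g} (suc m) (s≤s m≤f) (s≤s m≤g) with suc m % 2 ≟ 0
... | yes _ = cong suc (div2count-fuel (suc m / 2) (half≤ m≤f) (half≤ m≤g))
  where
  half≤ : ∀ {h} → m ≤ h → suc m / 2 ≤ h
  half≤ = ≤-trans (≤-pred (m/n<m (suc m) 2 ≤-refl))
... | no _  = refl

ν₂-double : ∀ n .{{_ : NonZero n}} → ν₂ (2 * n) ≡ suc (ν₂ n)
ν₂-double n@(suc k) with (2 * n) % 2 ≟ 0
... | no 2∤ = contradiction (trans (cong (_% 2) (*-comm 2 n)) (m*n%n≡0 n 2)) 2∤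
... | yes _ = cong suc (begin
  div2count (pred (2 * n)) (2 * n / 2) ≡⟨ cong (div2count (pred (2 * n))) (trans (cong (_/ 2) (*-comm 2 n)) (m*n/n≡m n 2)) ⟩
  div2count (pred (2 * n)) n           ≡⟨ div2count-fuel n n≤pred[2n] ≤-refl ⟩
  ν₂ n                                 ∎)
  where
  open ≡-Reasoning
  n≤pred[2n] : n ≤ pred (2 * n)
  n≤pred[2n] = ≤-trans (m≤n+m n k) (+-monoʳ-≤ k (m≤m+n n 0))

ν₂-odd : ∀ k → ν₂ (suc (2 * k)) ≡ 0
ν₂-odd k with suc (2 * k) % 2 ≟ 0
... | no _   = refl
... | yes 2∣ with trans (sym 2∣) (trans (cong (λ m → suc m % 2) (*-comm 2 k)) ([m+kn]%n≡m%n 1 k 2))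
...   | ()

bhat-double : ∀ n .{{_ : NonZero n}} → bhat (2 * n) ≡ suc (bhat n)
bhat-double n@(suc _) = ν₂-double (2 * n)

bhat-odd : ∀ k → bhat (suc (2 * k)) ≡ 1
bhat-odd k = trans (ν₂-double (suc (2 * k))) (cong suc (ν₂-odd k))

bhat-pos : ∀ n .{{_ : NonZero n}} → 0 < bhat n
bhat-pos n = subst (0 <_) (sym (ν₂-double n)) z<s

bhat-pow : ∀ q → bhat (2 ^ q) ≡ suc q
bhat-pow zero    = refl
bhat-pow (suc q) = trans (bhat-double (2 ^ q) {{m^n≢0 2 q}}) (cong suc (bhat-pow q))

data EvenOrOdd : ℕ → Set where
  even : ∀ k → EvenOrOdd (2 * k)
  odd  : ∀ k → EvenOrOdd (suc (2 * k))

evenOrOdd : ∀ n → EvenOrOdd n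
evenOrOdd zero = even 0
evenOrOdd (suc n) with evenOrOdd n
... | even k = odd k
... | odd k  = subst EvenOrOdd (*-suc 2 k) (even (suc k))

bhat-shift : ∀ q j .{{_ : NonZero j}} → j < 2 ^ q → bhat (2 ^ q + j) ≡ bhat j
bhat-shift zero    (suc j) (s≤s ())
bhat-shift (suc q) j j<2^[1+q] with evenOrOdd j
... | odd k = begin
  bhat (2 * 2 ^ q + suc (2 * k))  ≡⟨ cong bhat (trans (+-suc (2 * 2 ^ q) (2 * k))
                                                        (cong suc (sym (*-distribˡ-+ 2 (2 ^ q) k)))) ⟩
  bhat (suc (2 * (2 ^ q + k)))    ≡⟨ bhat-odd (2 ^ q + k) ⟩
  1                               ≡⟨ bhat-odd k ⟨
  bhat (suc (2 * k))              ∎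
  where open ≡-Reasoning
... | even (suc k) = begin
  bhat (2 * 2 ^ q + 2 * suc k)    ≡⟨ cong bhat (*-distribˡ-+ 2 (2 ^ q) (suc k)) ⟨
  bhat (2 * (2 ^ q + suc k))      ≡⟨ bhat-double (2 ^ q + suc k) {{≢-nonZero (m+1+n≢0 (2 ^ q))}} ⟩
  suc (bhat (2 ^ q + suc k))      ≡⟨ cong suc (bhat-shift q (suc k) (*-cancelˡ-< 2 (suc k) (2 ^ q) j<2^[1+q])) ⟩
  suc (bhat (suc k))              ≡⟨ bhat-double (suc k) ⟨
  bhat (2 * suc k)                ∎
  where open ≡-Reasoning

n≤bsum[n] : ∀ n → n ≤ bsum n
n≤bsum[n] zero    = z≤n
n≤bsum[n] (suc n) = ≤-trans (s≤s (n≤bsum[n] n)) (m<m+n (bsum n) (bhat-pos (suc n)))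

bsum-mono-≤ : ∀ {m n} → m ≤ n → bsum m ≤ bsum n
bsum-mono-≤ = mono ∘ ≤⇒≤′
  where
  mono : ∀ {m n} → m ≤′ n → bsum m ≤ bsum n
  mono ≤′-refl        = ≤-refl
  mono (≤′-step m≤′n) = ≤-trans (mono m≤′n) (m≤m+n _ _)

bsum-shift : ∀ q j → j < 2 ^ q → bsum (2 ^ q + j) ≡ bsum (2 ^ q) + bsum j
bsum-shift q zero    _ = trans (cong bsum (+-identityʳ (2 ^ q))) (sym (+-identityʳ _))
bsum-shift q (suc j) j<2^q = begin
  bsum (2 ^ q + suc j)                       ≡⟨ cong bsum (+-suc (2 ^ q) j) ⟩
  bsum (2 ^ q + j) + bhat (suc (2 ^ q + j))  ≡⟨ cong₂ _+_ (bsum-shift q j (<-trans (n<1+n j) j<2^q))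
                                                          (trans (cong bhat (sym (+-suc (2 ^ q) j))) (bhat-shift q (suc j) j<2^q)) ⟩
  bsum (2 ^ q) + bsum j + bhat (suc j)       ≡⟨ +-assoc (bsum (2 ^ q)) (bsum j) _ ⟩
  bsum (2 ^ q) + bsum (suc j)                ∎
  where open ≡-Reasoning

bsum-pow-pred : ∀ q → bsum (2 ^ q) ≡ bsum (pred (2 ^ q)) + suc q
bsum-pow-pred q = trans (unfold (2 ^ q) {{m^n≢0 2 q}}) (cong (bsum (pred (2 ^ q)) +_) (bhat-pow q))
  where
  unfold : ∀ n .{{_ : NonZero n}} → bsum n ≡ bsum (pred n) + bhat n
  unfold (suc n) = refl

bsum-pow-double : ∀ q → bsum (2 ^ q + 2 ^ q) ≡ suc (bsum (2 ^ q) + bsum (2 ^ q))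
bsum-pow-double q = begin
  bsum (P + P)                       ≡⟨ cong (λ n → bsum (P + n)) suc[p]≡P ⟨
  bsum (P + suc p)                   ≡⟨ cong bsum (+-suc P p) ⟩
  bsum (P + p) + bhat (suc (P + p))  ≡⟨ cong₂ _+_ (bsum-shift q p (≤-reflexive suc[p]≡P))
                                                  (cong bhat (trans (sym (+-suc P p)) (cong (P +_) suc[p]≡P))) ⟩
  bsum P + bsum p + bhat (P + P)     ≡⟨ cong (bsum P + bsum p +_) bhat[P+P] ⟩
  bsum P + bsum p + suc (suc q)      ≡⟨ trans (+-assoc (bsum P) (bsum p) _) (cong (bsum P +_) (+-suc (bsum p) (suc q))) ⟩
  bsum P + suc (bsum p + suc q)      ≡⟨ cong (λ n → bsum P + suc n) (bsum-pow-pred q) ⟨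
  bsum P + suc (bsum P)              ≡⟨ +-suc (bsum P) (bsum P) ⟩
  suc (bsum P + bsum P)              ∎
  where
  open ≡-Reasoning
  P = 2 ^ q
  p = pred P
  suc[p]≡P : suc p ≡ P
  suc[p]≡P = suc-pred P {{m^n≢0 2 q}}
  bhat[P+P] : bhat (P + P) ≡ suc (suc q)
  bhat[P+P] = trans (cong (λ n → bhat (P + n)) (sym (+-identityʳ P))) (bhat-pow (suc q))

suc-bsum-pow : ∀ q → suc (bsum (2 ^ q)) ≡ 2 ^ suc q
suc-bsum-pow zero    = refl
suc-bsum-pow (suc q) = begin
  suc (bsum (P + (P + 0)))            ≡⟨ cong (λ n → suc (bsum (P + n))) (+-identityʳ P) ⟩
  suc (bsum (P + P))                  ≡⟨ cong suc (bsum-pow-double q) ⟩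
  suc (suc (bsum P + bsum P))         ≡⟨ cong suc (+-suc (bsum P) (bsum P)) ⟨
  suc (bsum P) + suc (bsum P)         ≡⟨ cong₂ _+_ (suc-bsum-pow q) (suc-bsum-pow q) ⟩
  2 ^ suc q + 2 ^ suc q               ≡⟨ cong (2 ^ suc q +_) (+-identityʳ (2 ^ suc q)) ⟨
  2 * 2 ^ suc q                       ∎
  where
  open ≡-Reasoning
  P = 2 ^ q

bsum-shift-≤ : ∀ q j → j ≤ 2 ^ q → bsum (2 ^ q) + bsum j ≤ bsum (2 ^ q + j)
bsum-shift-≤ q j j≤2^q with m≤n⇒m<n∨m≡n j≤2^q
... | inj₁ j<2^q = ≤-reflexive (sym (bsum-shift q j j<2^q))
... | inj₂ refl  = ≤-trans (n≤1+n _) (≤-reflexive (sym (bsum-pow-double q)))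

search-least : ∀ f s n k → s ≤ k → k ≤ f + s → n ≤ bsum k → (∀ {j} → j < k → bsum j < n) →
               search f s n ≡ k
search-least zero    s n k s≤k k≤s _ _ = ≤-antisym s≤k k≤s
search-least (suc f) s n k s≤k k≤f+s n≤bsum[k] below with n ≤? bsum s
... | yes n≤bsum[s] = ≤-antisym s≤k (≮⇒≥ (λ s<k → <⇒≱ (below s<k) n≤bsum[s]))
... | no  n≰bsum[s] =
  search-least f (suc s) n k s<k (≤-trans k≤f+s (≤-reflexive (sym (+-suc f s)))) n≤bsum[k] below
  where
  s<k : s < k
  s<k = ≤∧≢⇒< s≤k (λ { refl → n≰bsum[s] n≤bsum[k] })

ahat-block : ∀ {n} k → bsum k < n → n ≤ bsum (suc k) → ahat n ≡ suc k
ahat-block {n} k bsum[k]<n n≤bsum[1+k] =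
  search-least n 1 n (suc k) (s≤s z≤n) 1+k≤n+1 n≤bsum[1+k] (λ j<1+k → ≤-<-trans (bsum-mono-≤ (≤-pred j<1+k)) bsum[k]<n)
  where
  1+k≤n+1 : suc k ≤ n + 1
  1+k≤n+1 = ≤-trans (≤-<-trans (n≤bsum[n] k) bsum[k]<n) (m≤m+n n 1)

bsum-bracket : ∀ m {n} → 0 < n → n ≤ bsum m → ∃[ k ] k < m × bsum k < n × n ≤ bsum (suc k)
bsum-bracket zero    (s≤s _) ()
bsum-bracket (suc m) {n} 0<n n≤bsum[1+m] with n ≤? bsum m
... | no  n≰bsum[m] = m , ≤-refl , ≰⇒> n≰bsum[m] , n≤bsum[1+m]
... | yes n≤bsum[m] with bsum-bracket m 0<n n≤bsum[m]
...   | k , k<m , bracket = k , m<n⇒m<1+n k<m , bracket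

ahat-run : ∀ k i → i < bhat (suc k) → ahat (suc (bsum k + i)) ≡ suc k
ahat-run k i i<bhat = ahat-block k (s≤s (m≤m+n (bsum k) i)) (+-monoʳ-< (bsum k) i<bhat)

ahat-shift : ∀ q {n} → 0 < n → n ≤ bsum (2 ^ q) → ahat (bsum (2 ^ q) + n) ≡ ahat n + 2 ^ q
ahat-shift q {n} 0<n n≤bsum[P] with bsum-bracket (2 ^ q) 0<n n≤bsum[P]
... | k , k<P , bsum[k]<n , n≤bsum[1+k] = begin
  ahat (bsum P + n) ≡⟨ ahat-block (P + k) lower upper ⟩
  suc (P + k)       ≡⟨ cong suc (+-comm P k) ⟩
  suc k + P         ≡⟨ cong (_+ P) (ahat-block k bsum[k]<n n≤bsum[1+k]) ⟨
  ahat n + P        ∎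
  where
  open ≡-Reasoning
  P = 2 ^ q
  lower : bsum (P + k) < bsum P + n
  lower = subst (_< bsum P + n) (sym (bsum-shift q k k<P)) (+-monoʳ-< (bsum P) bsum[k]<n)
  upper : bsum P + n ≤ bsum (suc (P + k))
  upper = ≤-trans (+-monoʳ-≤ (bsum P) n≤bsum[1+k])
         (≤-trans (bsum-shift-≤ q (suc k) k<P) (≤-reflexive (cong bsum (+-suc P k))))

module _ {a} {A : Set a} where

  applyUpTo-+ : ∀ (f : ℕ → A) m n → applyUpTo f (m + n) ≡ applyUpTo f m ++ applyUpTo (λ i → f (m + i)) n
  applyUpTo-+ f zero    n = refl
  applyUpTo-+ f (suc m) n = cong (f 0 ∷_) (applyUpTo-+ (f ∘ suc) m n)

  applyUpTo-cong : ∀ {f g : ℕ → A} n → (∀ {i} → i < n → f i ≡ g i) → applyUpTo f n ≡ applyUpTo g n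
  applyUpTo-cong zero    _   = refl
  applyUpTo-cong (suc n) f≡g = cong₂ _∷_ (f≡g z<s) (applyUpTo-cong n (f≡g ∘ s<s))

  applyUpTo-const : ∀ (x : A) n → applyUpTo (λ _ → x) n ≡ replicate n x
  applyUpTo-const x zero    = refl
  applyUpTo-const x (suc n) = cong (x ∷_) (applyUpTo-const x n)

-- ℓ q is the position of the first 2 ^ q in â, and the length of Â (suc q).
ℓ : ℕ → ℕ
ℓ q = suc (bsum (pred (2 ^ q)))

bsum-pow≡ℓ+ : ∀ q → bsum (2 ^ q) ≡ ℓ q + q
bsum-pow≡ℓ+ q = trans (bsum-pow-pred q) (+-suc (bsum (pred (2 ^ q))) q)

2^[1+q]≡ℓ+[1+q] : ∀ q → 2 ^ suc q ≡ ℓ q + suc q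
2^[1+q]≡ℓ+[1+q] q = trans (sym (suc-bsum-pow q)) (trans (cong suc (bsum-pow≡ℓ+ q)) (sym (+-suc (ℓ q) q)))

Ahat≡applyUpTo : ∀ h {n} → 2 ^ h ∸ h ≡ n → Ahat h ≡ applyUpTo (ahat ∘ suc) n
Ahat≡applyUpTo h {n} eq = trans (cong (map (ahat ∘ suc) ∘ upTo) eq) (map-upTo (ahat ∘ suc) n)

Ahat[1+q] : ∀ q → Ahat (suc q) ≡ applyUpTo (ahat ∘ suc) (ℓ q)
Ahat[1+q] q = Ahat≡applyUpTo (suc q) (trans (cong (_∸ suc q) (2^[1+q]≡ℓ+[1+q] q)) (m+n∸n≡m (ℓ q) (suc q)))

Ahat[2+q] : ∀ q → Ahat (suc (suc q)) ≡ applyUpTo (ahat ∘ suc) (ℓ q + (q + ℓ q))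
Ahat[2+q] q = Ahat≡applyUpTo (suc (suc q)) (begin
  2 * 2 ^ suc q ∸ suc (suc q)                ≡⟨ cong (λ m → 2 * m ∸ suc (suc q)) (2^[1+q]≡ℓ+[1+q] q) ⟩
  2 * (ℓ q + suc q) ∸ suc (suc q)            ≡⟨ cong (_∸ suc (suc q)) (regroup (ℓ q) q) ⟩
  ℓ q + (q + ℓ q) + suc (suc q) ∸ suc (suc q) ≡⟨ m+n∸n≡m (ℓ q + (q + ℓ q)) (suc (suc q)) ⟩
  ℓ q + (q + ℓ q)                            ∎)
  where
  open ≡-Reasoning
  regroup : ∀ l q → 2 * (l + suc q) ≡ l + (q + l) + suc (suc q)
  regroup = solve-∀

ahat-middle : ∀ q {i} → i < q → ahat (suc (ℓ q + i)) ≡ 2 ^ q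
ahat-middle q {i} i<q = begin
  ahat (suc (ℓ q + i))         ≡⟨ cong (ahat ∘ suc) (+-suc (bsum p) i) ⟨
  ahat (suc (bsum p + suc i))  ≡⟨ ahat-run p (suc i) (subst (suc i <_) (sym bhat[1+p]) (s≤s i<q)) ⟩
  suc p                        ≡⟨ suc[p]≡P ⟩
  2 ^ q                        ∎
  where
  open ≡-Reasoning
  p = pred (2 ^ q)
  suc[p]≡P : suc p ≡ 2 ^ q
  suc[p]≡P = suc-pred (2 ^ q) {{m^n≢0 2 q}}
  bhat[1+p] : bhat (suc p) ≡ suc q
  bhat[1+p] = trans (cong bhat suc[p]≡P) (bhat-pow q)

ahat-tail : ∀ q {i} → i < ℓ q → ahat (suc (ℓ q + (q + i))) ≡ ahat (suc i) + 2 ^ q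
ahat-tail q {i} i<ℓ = begin
  ahat (suc (ℓ q + (q + i)))   ≡⟨ cong ahat position ⟩
  ahat (bsum (2 ^ q) + suc i)  ≡⟨ ahat-shift q z<s 1+i≤bsum[P] ⟩
  ahat (suc i) + 2 ^ q         ∎
  where
  open ≡-Reasoning
  1+i≤bsum[P] : suc i ≤ bsum (2 ^ q)
  1+i≤bsum[P] = ≤-trans i<ℓ (≤-trans (m≤m+n (ℓ q) q) (≤-reflexive (sym (bsum-pow≡ℓ+ q))))
  position : suc (ℓ q + (q + i)) ≡ bsum (2 ^ q) + suc i
  position = begin
    suc (ℓ q + (q + i))   ≡⟨ cong suc (+-assoc (ℓ q) q i) ⟨
    suc (ℓ q + q + i)     ≡⟨ +-suc (ℓ q + q) i ⟨
    ℓ q + q + suc i       ≡⟨ cong (_+ suc i) (bsum-pow≡ℓ+ q) ⟨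
    bsum (2 ^ q) + suc i  ∎

lemmaB4 : (h : ℕ) → 1 ≤ h →
    Ahat (suc h) ≡ Ahat h ++ (replicate (h ∸ 1) (2 ^ (h ∸ 1)) ++ map (λ x → x + 2 ^ (h ∸ 1)) (Ahat h))
lemmaB4 (suc q) _ = begin
  Ahat (suc (suc q))
    ≡⟨ Ahat[2+q] q ⟩
  applyUpTo a (ℓ q + (q + ℓ q))
    ≡⟨ trans (applyUpTo-+ a (ℓ q) _) (cong (applyUpTo a (ℓ q) ++_) (applyUpTo-+ _ q (ℓ q))) ⟩
  applyUpTo a (ℓ q) ++ (applyUpTo (λ i → a (ℓ q + i)) q ++ applyUpTo (λ i → a (ℓ q + (q + i))) (ℓ q))
    ≡⟨ cong₂ (λ xs ys → applyUpTo a (ℓ q) ++ (xs ++ ys)) middle tail ⟩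
  applyUpTo a (ℓ q) ++ (replicate q (2 ^ q) ++ map (_+ 2 ^ q) (applyUpTo a (ℓ q)))
    ≡⟨ cong (λ xs → xs ++ (replicate q (2 ^ q) ++ map (_+ 2 ^ q) xs)) (Ahat[1+q] q) ⟨
  Ahat (suc q) ++ (replicate q (2 ^ q) ++ map (_+ 2 ^ q) (Ahat (suc q)))
    ∎
  where
  open ≡-Reasoning
  a : ℕ → ℕ
  a = ahat ∘ suc
  middle : applyUpTo (λ i → a (ℓ q + i)) q ≡ replicate q (2 ^ q)
  middle = trans (applyUpTo-cong q (ahat-middle q)) (applyUpTo-const (2 ^ q) q)
  tail : applyUpTo (λ i → a (ℓ q + (q + i))) (ℓ q) ≡ map (_+ 2 ^ q) (applyUpTo a (ℓ q))
  tail = trans (applyUpTo-cong (ℓ q) (ahat-tail q)) (sym (map-applyUpTo a (_+ 2 ^ q) (ℓ q)))
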